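{- Let $p_1,p_2,q_1,q_2$ be non-negative integers and let $l,t$ be integers with $0\le l,t\le p_1+p_2+q_1+q_2$. Then $$\sum_{r=0}^{q_1+q_2}\binom{p_1+p_2+r}{t}\binom{q_1+q_2}{r}S(p_1+p_2+r-t,l)=\sum_{m=0}^{p_2+q_2}\sum_{r_1=0}^{q_1}\sum_{r_2=0}^{q_2}\sum_{k=0}^{p_1+r_1}\sum_{s=0}^{k}\binom{q_1}{r_1}\binom{q_2}{r_2}\binom{p_1+r_1}{k}\binom{p_2+r_2}{t-s}\binom{k}{s}m^{k-s}S(p_2+r_2-t+s,m)\,S(p_1+r_1-k,l-m).$$
   Context: $S(n,k)$ denotes the Stirling numbers of the second kind, with $S(n,k)=0$ whenever $n<0$, $k<0$ or $k>n$. For non-negative integers $N$ and integers $i$, $\binom{N}{i}=0$ if $i<0$ or $i>N$. Also $0^0=1$. -}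

module Defs where

open import Data.Nat using (ℕ; zero; suc; _+_; _*_)
open import Data.Nat.Combinatorics using (_C_)
open import Data.Integer using (ℤ; +_; -[1+_])

stirling₂ : ℕ → ℕ → ℕ
stirling₂ zero    zero    = 1
stirling₂ zero    (suc k) = 0
stirling₂ (suc n) zero    = 0
stirling₂ (suc n) (suc k) = suc k * stirling₂ n (suc k) + stirling₂ n k

-- S(n,k) for integer arguments: 0 if n < 0 or k < 0 (and k > n gives 0 by the recurrence).
S : ℤ → ℤ → ℕ
S (+ n)    (+ k)    = stirling₂ n k
S (+ n)    -[1+ _ ] = 0
S -[1+ _ ] _        = 0

-- binom N i for N : ℕ, i : ℤ; 0 if i < 0 or i > N (stdlib's _C_ is 0 for i > N).
binom : ℕ → ℤ → ℕ
binom N (+ i)    = N C i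
binom N -[1+ _ ] = 0

Σ≤ : ℕ → (ℕ → ℕ) → ℕ
Σ≤ zero    f = f 0
Σ≤ (suc n) f = Σ≤ n f + f (suc n)

-- Vandermonde's convolution in r reduces the theorem to the identity, for a = p₁ + r₁ and b = p₂ + r₂,
--   C(a+b,t) S(a+b-t,l) = Σ_{m,k,s} C(a,k) C(b,t-s) C(k,s) m^(k-s) S(b-t+s,m) S(a-k,l-m).
-- Sum over s last and write k = s + j: since C(a,k) C(k,s) = C(a,s) C(a-s,j), the sums over j and m
-- become Σ_m S(b-t+s,m) S_m(a-s+m,l) with S_m an r-Stirling number, which the addition formula for
-- Stirling numbers evaluates to S(a+b-t,l). What remains is Vandermonde's Σ_s C(a,s) C(b,t-s) = C(a+b,t).
module Submission where

open import Defs
open import Algebra.Properties.CommutativeSemigroup using (interchange; x∙yz≈xz∙y; xy∙z≈y∙xz)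
open import Data.Integer using (ℤ; +_; -_; -[1+_]) renaming (_-_ to _-ℤ_; _+_ to _+ℤ_)
open import Data.Integer.Properties using (m-n≡m⊖n; ⊖-≥; ⊖-<; [1+m]⊖[1+n]≡m⊖n)
import Data.Integer.Tactic.RingSolver as ℤ-Solver
open import Data.Nat
  using (ℕ; zero; suc; _+_; _*_; _∸_; _^_; _≤_; _<_; _>_; _≤′_; ≤′-reflexive; ≤′-step; z≤n; s≤s; _!)
open import Data.Nat.Combinatorics
  using (_C_; nCk+nC[k+1]≡[n+1]C[k+1]; k>n⇒nCk≡0; nCk≡n!/k![n-k]!; k![n∸k]!∣n!)
open import Data.Nat.DivMod using (m/n*n≡m)
open import Data.Nat.Properties
open import Data.Nat.Tactic.RingSolver using (solve-∀)
open import Data.Product using (_,_)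
open import Data.Sum using (inj₁; inj₂)
open import Relation.Binary.PropositionalEquality
open import Relation.Nullary using (Dec; yes; no; contradiction)
open import Function using (_∘_)
open ≡-Reasoning

Σ≤-cong : ∀ n {f g : ℕ → ℕ} → (∀ i → i ≤ n → f i ≡ g i) → Σ≤ n f ≡ Σ≤ n g
Σ≤-cong zero    f≗g = f≗g 0 z≤n
Σ≤-cong (suc n) f≗g = cong₂ _+_ (Σ≤-cong n (λ i i≤n → f≗g i (m≤n⇒m≤1+n i≤n))) (f≗g (suc n) ≤-refl)

Σ≤-zero : ∀ n {f : ℕ → ℕ} → (∀ i → i ≤ n → f i ≡ 0) → Σ≤ n f ≡ 0
Σ≤-zero zero    f≗0 = f≗0 0 z≤n
Σ≤-zero (suc n) f≗0 = cong₂ _+_ (Σ≤-zero n (λ i i≤n → f≗0 i (m≤n⇒m≤1+n i≤n))) (f≗0 (suc n) ≤-refl)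

Σ≤-+ : ∀ n (f g : ℕ → ℕ) → Σ≤ n (λ i → f i + g i) ≡ Σ≤ n f + Σ≤ n g
Σ≤-+ zero    f g = refl
Σ≤-+ (suc n) f g = trans (cong (_+ (f (suc n) + g (suc n))) (Σ≤-+ n f g))
  (interchange +-commutativeSemigroup (Σ≤ n f) (Σ≤ n g) (f (suc n)) (g (suc n)))

*-distribˡ-Σ≤ : ∀ n c (f : ℕ → ℕ) → c * Σ≤ n f ≡ Σ≤ n (λ i → c * f i)
*-distribˡ-Σ≤ zero    c f = refl
*-distribˡ-Σ≤ (suc n) c f =
  trans (*-distribˡ-+ c (Σ≤ n f) (f (suc n))) (cong (_+ c * f (suc n)) (*-distribˡ-Σ≤ n c f))

*-distribʳ-Σ≤ : ∀ n c (f : ℕ → ℕ) → Σ≤ n f * c ≡ Σ≤ n (λ i → f i * c)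
*-distribʳ-Σ≤ n c f =
  trans (*-comm (Σ≤ n f) c) (trans (*-distribˡ-Σ≤ n c f) (Σ≤-cong n (λ i _ → *-comm c (f i))))

Σ≤-comm : ∀ n m (f : ℕ → ℕ → ℕ) →
  Σ≤ n (λ i → Σ≤ m (λ j → f i j)) ≡ Σ≤ m (λ j → Σ≤ n (λ i → f i j))
Σ≤-comm zero    m f = refl
Σ≤-comm (suc n) m f = trans (cong (_+ Σ≤ m (f (suc n))) (Σ≤-comm n m f))
  (sym (Σ≤-+ m (λ j → Σ≤ n (λ i → f i j)) (f (suc n))))

Σ≤-suc : ∀ n (f : ℕ → ℕ) → Σ≤ (suc n) f ≡ f 0 + Σ≤ n (λ i → f (suc i))
Σ≤-suc zero    f = refl
Σ≤-suc (suc n) f = trans (cong (_+ f (suc (suc n))) (Σ≤-suc n f)) (+-assoc (f 0) _ _)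

Σ≤-extend : ∀ {n N} (f : ℕ → ℕ) → n ≤ N → (∀ i → n < i → f i ≡ 0) → Σ≤ n f ≡ Σ≤ N f
Σ≤-extend {n} f n≤N f≗0 = go (≤⇒≤′ n≤N)
  where
  go : ∀ {N} → n ≤′ N → Σ≤ n f ≡ Σ≤ N f
  go (≤′-reflexive refl) = refl
  go (≤′-step {N} n≤′N) = begin
    Σ≤ n f               ≡⟨ go n≤′N ⟩
    Σ≤ N f               ≡⟨ +-identityʳ (Σ≤ N f) ⟨
    Σ≤ N f + 0           ≡⟨ cong (_+_ (Σ≤ N f)) (f≗0 (suc N) (s≤s (≤′⇒≤ n≤′N))) ⟨
    Σ≤ N f + f (suc N)   ∎

Σ≤-offset : ∀ s n (f : ℕ → ℕ) → (∀ k → k < s → f k ≡ 0) → Σ≤ (s + n) f ≡ Σ≤ n (λ j → f (s + j))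
Σ≤-offset zero    n f f≗0 = refl
Σ≤-offset (suc s) n f f≗0 = begin
  Σ≤ (suc (s + n)) f                        ≡⟨ Σ≤-suc (s + n) f ⟩
  f 0 + Σ≤ (s + n) (λ i → f (suc i))        ≡⟨ cong (_+ Σ≤ (s + n) (λ i → f (suc i))) (f≗0 0 (s≤s z≤n)) ⟩
  Σ≤ (s + n) (λ i → f (suc i))              ≡⟨ Σ≤-offset s n (λ i → f (suc i)) (λ k k<s → f≗0 (suc k) (s≤s k<s)) ⟩
  Σ≤ n (λ j → f (suc (s + j)))              ∎

Σ≤-delta : ∀ n u (f : ℕ → ℕ) → u ≤ n → (∀ i → i ≢ u → f i ≡ 0) → Σ≤ n f ≡ f u
Σ≤-delta zero    .zero f z≤n f≗0 = refl
Σ≤-delta (suc n) u     f u≤1+n f≗0 with m≤n⇒m<n∨m≡n u≤1+n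
... | inj₁ (s≤s u≤n) = begin
  Σ≤ n f + f (suc n)  ≡⟨ cong (_+_ (Σ≤ n f)) (f≗0 (suc n) (λ n+1≡u → <⇒≢ (s≤s u≤n) (sym n+1≡u))) ⟩
  Σ≤ n f + 0          ≡⟨ +-identityʳ (Σ≤ n f) ⟩
  Σ≤ n f              ≡⟨ Σ≤-delta n u f u≤n f≗0 ⟩
  f u                 ∎
... | inj₂ refl = cong (_+ f (suc n)) (Σ≤-zero n (λ i i≤n → f≗0 i (<⇒≢ (s≤s i≤n))))

C*-cong : ∀ n k {x y} → (k ≤ n → x ≡ y) → (n C k) * x ≡ (n C k) * y
C*-cong n k x≡y with k ≤? n
... | yes k≤n = cong ((n C k) *_) (x≡y k≤n)
... | no  k≰n rewrite k>n⇒nCk≡0 (≰⇒> k≰n) = refl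

C-factorial : ∀ j i → ((j + i) C j) * (j ! * i !) ≡ (j + i) !
C-factorial j i with nCk≡n!/k![n-k]! (m≤m+n j i) | k![n∸k]!∣n! (m≤m+n j i)
... | nCk≡ | k![n-k]!∣n! rewrite m+n∸m≡n j i =
  trans (cong (_* (j ! * i !)) nCk≡) (m/n*n≡m {{j !* i !≢0}} k![n-k]!∣n!)

C-trinomial : ∀ s {j a} → j ≤ a → ((s + a) C (s + j)) * ((s + j) C s) ≡ ((s + a) C s) * (a C j)
C-trinomial s {j} j≤a with m≤n⇒∃[o]m+o≡n j≤a
... | i , refl = *-cancelʳ-≡ _ _ (s ! * j ! * i !) {{m*n≢0 _ _ {{s !* j !≢0}} {{i !≢0}}}} (begin
  (N C (s + j)) * ((s + j) C s) * (s ! * j ! * i !)    ≡⟨ regroupˡ (N C (s + j)) ((s + j) C s) (s !) (j !) (i !) ⟩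
  (N C (s + j)) * (((s + j) C s) * (s ! * j !) * i !)  ≡⟨ cong (λ x → (N C (s + j)) * (x * i !)) (C-factorial s j) ⟩
  (N C (s + j)) * ((s + j) ! * i !)                    ≡⟨ cong (λ n → (n C (s + j)) * ((s + j) ! * i !)) (+-assoc s j i) ⟨
  ((s + j + i) C (s + j)) * ((s + j) ! * i !)          ≡⟨ C-factorial (s + j) i ⟩
  (s + j + i) !                                        ≡⟨ cong _! (+-assoc s j i) ⟩
  N !                                                  ≡⟨ C-factorial s (j + i) ⟨
  (N C s) * (s ! * (j + i) !)                          ≡⟨ cong (λ x → (N C s) * (s ! * x)) (C-factorial j i) ⟨
  (N C s) * (s ! * (((j + i) C j) * (j ! * i !)))      ≡⟨ regroupʳ (N C s) ((j + i) C j) (s !) (j !) (i !) ⟩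
  (N C s) * ((j + i) C j) * (s ! * j ! * i !)          ∎)
  where
  N = s + (j + i)
  regroupˡ : ∀ a b x y z → a * b * (x * y * z) ≡ a * (b * (x * y) * z)
  regroupˡ = solve-∀
  regroupʳ : ∀ a b x y z → a * (x * (b * (y * z))) ≡ a * b * (x * y * z)
  regroupʳ = solve-∀

Σ≤-pascal : ∀ n (G : ℕ → ℕ) →
  Σ≤ (suc n) (λ r → (suc n C r) * G r) ≡ Σ≤ n (λ r → (n C r) * G r) + Σ≤ n (λ r → (n C r) * G (suc r))
Σ≤-pascal n G = begin
  Σ≤ (suc n) (λ r → (suc n C r) * G r)
    ≡⟨ Σ≤-suc n _ ⟩
  1 * G 0 + Σ≤ n (λ r → (suc n C suc r) * G (suc r))
    ≡⟨ cong (_+_ (1 * G 0)) (Σ≤-cong n λ r _ →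
         trans (cong (_* G (suc r)) (sym (nCk+nC[k+1]≡[n+1]C[k+1] n r))) (*-distribʳ-+ (G (suc r)) (n C r) _)) ⟩
  1 * G 0 + Σ≤ n (λ r → (n C r) * G (suc r) + (n C suc r) * G (suc r))
    ≡⟨ cong (_+_ (1 * G 0)) (Σ≤-+ n _ _) ⟩
  1 * G 0 + (Σ≤ n (λ r → (n C r) * G (suc r)) + Σ≤ n (λ r → (n C suc r) * G (suc r)))
    ≡⟨ x∙yz≈xz∙y +-commutativeSemigroup (1 * G 0) _ _ ⟩
  1 * G 0 + Σ≤ n (λ r → (n C suc r) * G (suc r)) + Σ≤ n (λ r → (n C r) * G (suc r))
    ≡⟨ cong (_+ Σ≤ n (λ r → (n C r) * G (suc r))) (Σ≤-suc n (λ r → (n C r) * G r)) ⟨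
  Σ≤ (suc n) (λ r → (n C r) * G r) + Σ≤ n (λ r → (n C r) * G (suc r))
    ≡⟨ cong (_+ Σ≤ n (λ r → (n C r) * G (suc r)))
            (Σ≤-extend _ (n≤1+n n) λ r n<r → cong (_* G r) (k>n⇒nCk≡0 n<r)) ⟨
  Σ≤ n (λ r → (n C r) * G r) + Σ≤ n (λ r → (n C r) * G (suc r))
    ∎

Σ≤-vandermonde : ∀ q₁ q₂ (F : ℕ → ℕ) →
  Σ≤ (q₁ + q₂) (λ r → ((q₁ + q₂) C r) * F r)
    ≡ Σ≤ q₁ (λ r₁ → (q₁ C r₁) * Σ≤ q₂ (λ r₂ → (q₂ C r₂) * F (r₁ + r₂)))
Σ≤-vandermonde zero     q₂ F = sym (*-identityˡ _)
Σ≤-vandermonde (suc q₁) q₂ F = begin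
  Σ≤ (suc (q₁ + q₂)) (λ r → (suc (q₁ + q₂) C r) * F r)
    ≡⟨ Σ≤-pascal (q₁ + q₂) F ⟩
  Σ≤ (q₁ + q₂) (λ r → ((q₁ + q₂) C r) * F r) + Σ≤ (q₁ + q₂) (λ r → ((q₁ + q₂) C r) * F (suc r))
    ≡⟨ cong₂ _+_ (Σ≤-vandermonde q₁ q₂ F) (Σ≤-vandermonde q₁ q₂ (λ r → F (suc r))) ⟩
  Σ≤ q₁ (λ r₁ → (q₁ C r₁) * H r₁) + Σ≤ q₁ (λ r₁ → (q₁ C r₁) * H (suc r₁))
    ≡⟨ Σ≤-pascal q₁ H ⟨
  Σ≤ (suc q₁) (λ r₁ → (suc q₁ C r₁) * H r₁)
    ∎
  where
  H : ℕ → ℕ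
  H r₁ = Σ≤ q₂ (λ r₂ → (q₂ C r₂) * F (r₁ + r₂))

-ℤ-≥ : ∀ {m n} → n ≤ m → + m -ℤ + n ≡ + (m ∸ n)
-ℤ-≥ {m} {n} n≤m = trans (m-n≡m⊖n m n) (⊖-≥ n≤m)

-ℤ-< : ∀ {m n} → m < n → + m -ℤ + n ≡ -[1+ n ∸ suc m ]
-ℤ-< {m} {n} m<n = trans (m-n≡m⊖n m n) (trans (⊖-< m<n) (cong (λ k → - (+ k)) (+-∸-assoc 1 m<n)))

vandermonde : ∀ a b t → Σ≤ a (λ s → (a C s) * binom b (+ t -ℤ + s)) ≡ (a + b) C t
vandermonde zero    b t = trans (+-identityʳ _) (cong (binom b) (-ℤ-≥ {t} z≤n))
vandermonde (suc a) b zero = begin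
  Σ≤ (suc a) (λ s → (suc a C s) * binom b (+ 0 -ℤ + s))
    ≡⟨ Σ≤-pascal a (λ s → binom b (+ 0 -ℤ + s)) ⟩
  Σ≤ a (λ s → (a C s) * binom b (+ 0 -ℤ + s)) + Σ≤ a (λ s → (a C s) * 0)
    ≡⟨ cong₂ _+_ (vandermonde a b zero) (Σ≤-zero a (λ s _ → *-zeroʳ (a C s))) ⟩
  1 ∎
vandermonde (suc a) b (suc t) = begin
  Σ≤ (suc a) (λ s → (suc a C s) * binom b (+ suc t -ℤ + s))
    ≡⟨ Σ≤-pascal a (λ s → binom b (+ suc t -ℤ + s)) ⟩
  Σ≤ a (λ s → (a C s) * binom b (+ suc t -ℤ + s)) + Σ≤ a (λ s → (a C s) * binom b (+ suc t -ℤ + suc s))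
    ≡⟨ cong (_+_ (Σ≤ a (λ s → (a C s) * binom b (+ suc t -ℤ + s))))
         (Σ≤-cong a λ s _ → cong (λ i → (a C s) * binom b i) (trans ([1+m]⊖[1+n]≡m⊖n t s) (sym (m-n≡m⊖n t s)))) ⟩
  Σ≤ a (λ s → (a C s) * binom b (+ suc t -ℤ + s)) + Σ≤ a (λ s → (a C s) * binom b (+ t -ℤ + s))
    ≡⟨ cong₂ _+_ (vandermonde a b (suc t)) (vandermonde a b t) ⟩
  (a + b) C suc t + (a + b) C t
    ≡⟨ +-comm ((a + b) C suc t) _ ⟩
  (a + b) C t + (a + b) C suc t
    ≡⟨ nCk+nC[k+1]≡[n+1]C[k+1] (a + b) t ⟩
  suc (a + b) C suc t ∎

k>n⇒stirling₂≡0 : ∀ {n k} → k > n → stirling₂ n k ≡ 0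
k>n⇒stirling₂≡0 {zero}  {suc k} _         = refl
k>n⇒stirling₂≡0 {suc n} {suc k} (s≤s k>n)
  rewrite k>n⇒stirling₂≡0 {n} {suc k} (m<n⇒m<1+n k>n) | k>n⇒stirling₂≡0 k>n = trans (+-identityʳ _) (*-zeroʳ (suc k))

-- stirling₂∸ n l m is S(n, l - m); unlike stirling₂ n (l ∸ m) it vanishes for m > l.
stirling₂∸ : ℕ → ℕ → ℕ → ℕ
stirling₂∸ n l       zero    = stirling₂ n l
stirling₂∸ n zero    (suc m) = 0
stirling₂∸ n (suc l) (suc m) = stirling₂∸ n l m

m>l⇒stirling₂∸≡0 : ∀ n {l m} → m > l → stirling₂∸ n l m ≡ 0
m>l⇒stirling₂∸≡0 n {zero}  {suc m} _         = refl
m>l⇒stirling₂∸≡0 n {suc l} {suc m} (s≤s m>l) = m>l⇒stirling₂∸≡0 n m>l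

stirling₂∸-≤ : ∀ n {l m} → m ≤ l → stirling₂∸ n l m ≡ stirling₂ n (l ∸ m)
stirling₂∸-≤ n {l}     {zero}  _         = refl
stirling₂∸-≤ n {suc l} {suc m} (s≤s m≤l) = stirling₂∸-≤ n m≤l

stirling₂∸-zero-≢ : ∀ {l m} → m ≢ l → stirling₂∸ 0 l m ≡ 0
stirling₂∸-zero-≢ {zero}  {zero}  m≢l = contradiction refl m≢l
stirling₂∸-zero-≢ {suc l} {zero}  _   = refl
stirling₂∸-zero-≢ {zero}  {suc m} _   = refl
stirling₂∸-zero-≢ {suc l} {suc m} m≢l = stirling₂∸-zero-≢ (m≢l ∘ cong suc)

stirling₂∸-zero-diag : ∀ l → stirling₂∸ 0 l l ≡ 1
stirling₂∸-zero-diag zero    = refl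
stirling₂∸-zero-diag (suc l) = stirling₂∸-zero-diag l

stirling₂∸-suc : ∀ n l m →
  stirling₂∸ (suc n) (suc l) m ≡ (suc l ∸ m) * stirling₂∸ n (suc l) m + stirling₂∸ n l m
stirling₂∸-suc n l       zero          = refl
stirling₂∸-suc n zero    (suc zero)    = refl
stirling₂∸-suc n zero    (suc (suc m)) = refl
stirling₂∸-suc n (suc l) (suc m)       = stirling₂∸-suc n l m

-- Broder's r-Stirling number S_m(n + m, l): j of the n ordinary elements join the blocks
-- of the m distinguished ones, the other n - j form the remaining l - m blocks.
rStirling : ℕ → ℕ → ℕ → ℕ
rStirling n m l = Σ≤ n (λ j → (n C j) * (m ^ j * stirling₂∸ (n ∸ j) l m))

m>l⇒rStirling≡0 : ∀ n {l m} → m > l → rStirling n m l ≡ 0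
m>l⇒rStirling≡0 n {l} {m} m>l = Σ≤-zero n λ j _ → begin
  (n C j) * (m ^ j * stirling₂∸ (n ∸ j) l m)  ≡⟨ cong (λ x → (n C j) * (m ^ j * x)) (m>l⇒stirling₂∸≡0 (n ∸ j) m>l) ⟩
  (n C j) * (m ^ j * 0)                       ≡⟨ cong ((n C j) *_) (*-zeroʳ (m ^ j)) ⟩
  (n C j) * 0                                 ≡⟨ *-zeroʳ (n C j) ⟩
  0                                           ∎

rStirling-zero : ∀ m l → rStirling 0 m l ≡ stirling₂∸ 0 l m
rStirling-zero m l = trans (+-identityʳ _) (+-identityʳ _)

rStirling-suc : ∀ n m l →
  rStirling (suc n) m l ≡ Σ≤ n (λ j → (n C j) * (m ^ j * stirling₂∸ (suc (n ∸ j)) l m)) + m * rStirling n m l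
rStirling-suc n m l = begin
  rStirling (suc n) m l
    ≡⟨ Σ≤-pascal n (λ j → m ^ j * stirling₂∸ (suc n ∸ j) l m) ⟩
  Σ≤ n (λ j → (n C j) * (m ^ j * stirling₂∸ (suc n ∸ j) l m))
    + Σ≤ n (λ j → (n C j) * (m * m ^ j * stirling₂∸ (n ∸ j) l m))
    ≡⟨ cong₂ _+_ (Σ≤-cong n λ j j≤n → cong (λ x → (n C j) * (m ^ j * stirling₂∸ x l m)) (+-∸-assoc 1 j≤n))
                 (trans (Σ≤-cong n λ j _ → pull-m (n C j) m (m ^ j) _) (sym (*-distribˡ-Σ≤ n m _))) ⟩
  Σ≤ n (λ j → (n C j) * (m ^ j * stirling₂∸ (suc (n ∸ j)) l m)) + m * rStirling n m l
    ∎
  where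
  pull-m : ∀ c m x y → c * (m * x * y) ≡ m * (c * (x * y))
  pull-m = solve-∀

rStirling-suc-zero : ∀ n m → rStirling (suc n) m 0 ≡ 0
rStirling-suc-zero n (suc m) = m>l⇒rStirling≡0 (suc n) (s≤s z≤n)
rStirling-suc-zero n zero    = trans (rStirling-suc n 0 0) (trans (+-identityʳ _)
  (Σ≤-zero n λ j _ → trans (cong ((n C j) *_) (*-zeroʳ (0 ^ j))) (*-zeroʳ (n C j))))

rStirling-suc-suc : ∀ n m l → rStirling (suc n) m (suc l) ≡ suc l * rStirling n m (suc l) + rStirling n m l
rStirling-suc-suc n m l = begin
  rStirling (suc n) m (suc l)
    ≡⟨ rStirling-suc n m (suc l) ⟩
  Σ≤ n (λ j → (n C j) * (m ^ j * stirling₂∸ (suc (n ∸ j)) (suc l) m)) + m * R (suc l)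
    ≡⟨ cong (_+ m * R (suc l)) (Σ≤-cong n λ j _ →
         trans (cong (λ x → (n C j) * (m ^ j * x)) (stirling₂∸-suc (n ∸ j) l m))
               (distribute (n C j) (m ^ j) (suc l ∸ m) _ _)) ⟩
  Σ≤ n (λ j → (suc l ∸ m) * ((n C j) * (m ^ j * stirling₂∸ (n ∸ j) (suc l) m))
               + (n C j) * (m ^ j * stirling₂∸ (n ∸ j) l m))
    + m * R (suc l)
    ≡⟨ cong (_+ m * R (suc l)) (trans (Σ≤-+ n _ _) (cong (_+ R l) (sym (*-distribˡ-Σ≤ n (suc l ∸ m) _)))) ⟩
  (suc l ∸ m) * R (suc l) + R l + m * R (suc l)
    ≡⟨ collect (suc l ∸ m) (R (suc l)) (R l) m ⟩
  (suc l ∸ m + m) * R (suc l) + R l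
    ≡⟨ cong (_+ R l) absorb-m ⟩
  suc l * R (suc l) + R l
    ∎
  where
  R : ℕ → ℕ
  R = rStirling n m
  distribute : ∀ a b c d e → a * (b * (c * d + e)) ≡ c * (a * (b * d)) + a * (b * e)
  distribute = solve-∀
  collect : ∀ c x y m → c * x + y + m * x ≡ (c + m) * x + y
  collect = solve-∀
  absorb-m : (suc l ∸ m + m) * R (suc l) ≡ suc l * R (suc l)
  absorb-m with m ≤? suc l
  ... | yes m≤1+l = cong (_* R (suc l)) (m∸n+n≡m m≤1+l)
  ... | no  m≰1+l rewrite m>l⇒rStirling≡0 n (≰⇒> m≰1+l) = trans (*-zeroʳ (suc l ∸ m + m)) (sym (*-zeroʳ (suc l)))

-- Both sides satisfy the recurrence of stirling₂ in (n, l).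
stirling₂-addition : ∀ n b M l → b ≤ M → Σ≤ M (λ m → stirling₂ b m * rStirling n m l) ≡ stirling₂ (b + n) l
stirling₂-addition zero b M l b≤M = begin
  Σ≤ M (λ m → stirling₂ b m * rStirling 0 m l)       ≡⟨ Σ≤-cong M (λ m _ → cong (stirling₂ b m *_) (rStirling-zero m l)) ⟩
  Σ≤ M (λ m → stirling₂ b m * stirling₂∸ 0 l m)      ≡⟨ diagonal (l ≤? M) ⟩
  stirling₂ b l                                      ≡⟨ cong (λ n → stirling₂ n l) (+-identityʳ b) ⟨
  stirling₂ (b + 0) l                                ∎
  where
  off-diagonal : ∀ m → m ≢ l → stirling₂ b m * stirling₂∸ 0 l m ≡ 0
  off-diagonal m m≢l = trans (cong (stirling₂ b m *_) (stirling₂∸-zero-≢ m≢l)) (*-zeroʳ (stirling₂ b m))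
  diagonal : Dec (l ≤ M) → Σ≤ M (λ m → stirling₂ b m * stirling₂∸ 0 l m) ≡ stirling₂ b l
  diagonal (yes l≤M) = begin
    Σ≤ M (λ m → stirling₂ b m * stirling₂∸ 0 l m) ≡⟨ Σ≤-delta M l _ l≤M off-diagonal ⟩
    stirling₂ b l * stirling₂∸ 0 l l              ≡⟨ cong (stirling₂ b l *_) (stirling₂∸-zero-diag l) ⟩
    stirling₂ b l * 1                             ≡⟨ *-identityʳ (stirling₂ b l) ⟩
    stirling₂ b l                                 ∎
  diagonal (no l≰M) = begin
    Σ≤ M (λ m → stirling₂ b m * stirling₂∸ 0 l m) ≡⟨ Σ≤-zero M (λ m m≤M → off-diagonal m λ { refl → l≰M m≤M }) ⟩
    0                                             ≡⟨ k>n⇒stirling₂≡0 (≤-<-trans b≤M (≰⇒> l≰M)) ⟨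
    stirling₂ b l                                 ∎
stirling₂-addition (suc n) b M zero b≤M = begin
  Σ≤ M (λ m → stirling₂ b m * rStirling (suc n) m 0)
    ≡⟨ Σ≤-zero M (λ m _ → trans (cong (stirling₂ b m *_) (rStirling-suc-zero n m)) (*-zeroʳ (stirling₂ b m))) ⟩
  0
    ≡⟨ cong (λ k → stirling₂ k 0) (+-suc b n) ⟨
  stirling₂ (b + suc n) 0 ∎
stirling₂-addition (suc n) b M (suc l) b≤M = begin
  Σ≤ M (λ m → stirling₂ b m * rStirling (suc n) m (suc l))
    ≡⟨ Σ≤-cong M (λ m _ → trans (cong (stirling₂ b m *_) (rStirling-suc-suc n m l))
                                (distribute (stirling₂ b m) (suc l) _ _)) ⟩
  Σ≤ M (λ m → suc l * (stirling₂ b m * rStirling n m (suc l)) + stirling₂ b m * rStirling n m l)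
    ≡⟨ trans (Σ≤-+ M _ _)
             (cong (_+ Σ≤ M (λ m → stirling₂ b m * rStirling n m l)) (sym (*-distribˡ-Σ≤ M (suc l) _))) ⟩
  suc l * Σ≤ M (λ m → stirling₂ b m * rStirling n m (suc l)) + Σ≤ M (λ m → stirling₂ b m * rStirling n m l)
    ≡⟨ cong₂ (λ x y → suc l * x + y) (stirling₂-addition n b M (suc l) b≤M) (stirling₂-addition n b M l b≤M) ⟩
  suc l * stirling₂ (b + n) (suc l) + stirling₂ (b + n) l
    ≡⟨ cong (λ k → stirling₂ k (suc l)) (+-suc b n) ⟨
  stirling₂ (b + suc n) (suc l) ∎
  where
  distribute : ∀ s c x y → s * (c * x + y) ≡ c * (s * x) + s * y
  distribute = solve-∀

nCi*S[n-i]≡nCi*S[n∸i] : ∀ n i L → (n C i) * S (+ n -ℤ + i) L ≡ (n C i) * S (+ (n ∸ i)) L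
nCi*S[n-i]≡nCi*S[n∸i] n i L = C*-cong n i (λ i≤n → cong (λ x → S x L) (-ℤ-≥ i≤n))

S[n,l-m]≡stirling₂∸ : ∀ n l m → S (+ n) (+ l -ℤ + m) ≡ stirling₂∸ n l m
S[n,l-m]≡stirling₂∸ n l m with m ≤? l
... | yes m≤l rewrite -ℤ-≥ m≤l = sym (stirling₂∸-≤ n m≤l)
... | no  m≰l rewrite -ℤ-< (≰⇒> m≰l) = sym (m>l⇒stirling₂∸≡0 n (≰⇒> m≰l))

b∸[t∸s]+[a∸s]≡a+b∸t : ∀ {a b s t} → s ≤ a → s ≤ t → t ∸ s ≤ b → b ∸ (t ∸ s) + (a ∸ s) ≡ a + b ∸ t
b∸[t∸s]+[a∸s]≡a+b∸t {a} {b} {s} {t} s≤a s≤t t∸s≤b = begin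
  b ∸ (t ∸ s) + (a ∸ s)    ≡⟨ +-comm (b ∸ (t ∸ s)) (a ∸ s) ⟩
  a ∸ s + (b ∸ (t ∸ s))    ≡⟨ +-∸-assoc (a ∸ s) t∸s≤b ⟨
  a ∸ s + b ∸ (t ∸ s)      ≡⟨ cong (_∸ (t ∸ s)) (+-∸-comm b s≤a) ⟨
  a + b ∸ s ∸ (t ∸ s)      ≡⟨ ∸-+-assoc (a + b) s (t ∸ s) ⟩
  a + b ∸ (s + (t ∸ s))    ≡⟨ cong (a + b ∸_) (m+[n∸m]≡n s≤t) ⟩
  a + b ∸ t                ∎

Σ≤-trinomial-rStirling : ∀ m l {s a} → s ≤ a →
  Σ≤ a (λ k → (a C k) * (k C s) * (m ^ (k ∸ s) * stirling₂∸ (a ∸ k) l m)) ≡ (a C s) * rStirling (a ∸ s) m l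
Σ≤-trinomial-rStirling m l {s} s≤a with m≤n⇒∃[o]m+o≡n s≤a
... | a , refl = begin
  Σ≤ (s + a) (λ k → ((s + a) C k) * (k C s) * (m ^ (k ∸ s) * stirling₂∸ (s + a ∸ k) l m))
    ≡⟨ Σ≤-offset s a _ (λ k k<s → trans
         (cong (λ x → ((s + a) C k) * x * (m ^ (k ∸ s) * stirling₂∸ (s + a ∸ k) l m)) (k>n⇒nCk≡0 k<s))
         (cong (_* (m ^ (k ∸ s) * stirling₂∸ (s + a ∸ k) l m)) (*-zeroʳ ((s + a) C k)))) ⟩
  Σ≤ a (λ j → ((s + a) C (s + j)) * ((s + j) C s) * (m ^ (s + j ∸ s) * stirling₂∸ (s + a ∸ (s + j)) l m))
    ≡⟨ Σ≤-cong a (λ j j≤a → cong₂ _*_ (C-trinomial s j≤a)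
         (cong₂ (λ e n → m ^ e * stirling₂∸ n l m) (m+n∸m≡n s j) ([m+n]∸[m+o]≡n∸o s a j))) ⟩
  Σ≤ a (λ j → ((s + a) C s) * (a C j) * (m ^ j * stirling₂∸ (a ∸ j) l m))
    ≡⟨ Σ≤-cong a (λ j _ → *-assoc ((s + a) C s) (a C j) _) ⟩
  Σ≤ a (λ j → ((s + a) C s) * ((a C j) * (m ^ j * stirling₂∸ (a ∸ j) l m)))
    ≡⟨ *-distribˡ-Σ≤ a ((s + a) C s) _ ⟨
  ((s + a) C s) * rStirling a m l
    ≡⟨ cong (λ n → ((s + a) C s) * rStirling n m l) (m+n∸m≡n s a) ⟨
  ((s + a) C s) * rStirling (s + a ∸ s) m l
    ∎

module _ (t l : ℕ) where

  -- The summand of the theorem without the factors C(q₁,r₁) C(q₂,r₂), with a = p₁ + r₁, b = p₂ + r₂.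
  summand : ℕ → ℕ → ℕ → ℕ → ℕ → ℕ
  summand a b m k s = binom a (+ k) * binom b (+ t -ℤ + s) * binom k (+ s) * m ^ (k ∸ s)
                    * S (+ b -ℤ + t +ℤ + s) (+ m) * S (+ a -ℤ + k) (+ l -ℤ + m)

  summand-k<s : ∀ a b m {k s} → k < s → summand a b m k s ≡ 0
  summand-k<s a b m {k} {s} k<s
    rewrite k>n⇒nCk≡0 k<s | *-zeroʳ ((a C k) * binom b (+ t -ℤ + s)) = refl

  summand-t<s : ∀ a b m k {s} → t < s → summand a b m k s ≡ 0
  summand-t<s a b m k t<s rewrite -ℤ-< t<s | *-zeroʳ (a C k) = refl

  summand-s≤t : ∀ a b m k {s} → s ≤ t → summand a b m k s ≡
    (b C (t ∸ s)) * stirling₂ (b ∸ (t ∸ s)) m * ((a C k) * (k C s) * (m ^ (k ∸ s) * stirling₂∸ (a ∸ k) l m))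
  summand-s≤t a b m k {s} s≤t = begin
    summand a b m k s
      ≡⟨ cong₂ (λ i j → (a C k) * binom b i * (k C s) * m ^ (k ∸ s) * S j (+ m) * S (+ a -ℤ + k) (+ l -ℤ + m))
               (-ℤ-≥ s≤t) b-t+s≡b-[t∸s] ⟩
    (a C k) * (b C d) * (k C s) * m ^ (k ∸ s) * S (+ b -ℤ + d) (+ m) * S (+ a -ℤ + k) (+ l -ℤ + m)
      ≡⟨ regroup (a C k) (b C d) (k C s) (m ^ (k ∸ s)) _ _ ⟩
    ((b C d) * S (+ b -ℤ + d) (+ m)) * (((a C k) * S (+ a -ℤ + k) (+ l -ℤ + m)) * ((k C s) * m ^ (k ∸ s)))
      ≡⟨ cong₂ (λ x y → x * (y * ((k C s) * m ^ (k ∸ s))))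
               (nCi*S[n-i]≡nCi*S[n∸i] b d (+ m)) (nCi*S[n-i]≡nCi*S[n∸i] a k (+ l -ℤ + m)) ⟩
    ((b C d) * stirling₂ (b ∸ d) m) * (((a C k) * S (+ (a ∸ k)) (+ l -ℤ + m)) * ((k C s) * m ^ (k ∸ s)))
      ≡⟨ cong (λ x → ((b C d) * stirling₂ (b ∸ d) m) * (((a C k) * x) * ((k C s) * m ^ (k ∸ s))))
              (S[n,l-m]≡stirling₂∸ (a ∸ k) l m) ⟩
    ((b C d) * stirling₂ (b ∸ d) m) * (((a C k) * stirling₂∸ (a ∸ k) l m) * ((k C s) * m ^ (k ∸ s)))
      ≡⟨ cong (((b C d) * stirling₂ (b ∸ d) m) *_) (regroup′ (a C k) _ (k C s) (m ^ (k ∸ s))) ⟩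
    (b C d) * stirling₂ (b ∸ d) m * ((a C k) * (k C s) * (m ^ (k ∸ s) * stirling₂∸ (a ∸ k) l m))
      ∎
    where
    d = t ∸ s
    x-y+z≡x-[y-z] : ∀ (x y z : ℤ) → x -ℤ y +ℤ z ≡ x -ℤ (y -ℤ z)
    x-y+z≡x-[y-z] = ℤ-Solver.solve-∀
    b-t+s≡b-[t∸s] : + b -ℤ + t +ℤ + s ≡ + b -ℤ + d
    b-t+s≡b-[t∸s] = trans (x-y+z≡x-[y-z] (+ b) (+ t) (+ s)) (cong (λ i → + b -ℤ i) (-ℤ-≥ s≤t))
    regroup : ∀ x y z w u v → x * y * z * w * u * v ≡ (y * u) * ((x * v) * (z * w))
    regroup = solve-∀
    regroup′ : ∀ x y z w → x * y * (z * w) ≡ x * z * (w * y)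
    regroup′ = solve-∀

  Σ≤-summand-at : ∀ {a b} M {s} → b ≤ M → s ≤ a →
    Σ≤ M (λ m → Σ≤ a (λ k → summand a b m k s)) ≡ (a C s) * binom b (+ t -ℤ + s) * stirling₂ (a + b ∸ t) l
  Σ≤-summand-at {a} {b} M {s} b≤M s≤a with s ≤? t
  ... | no s≰t = begin
    Σ≤ M (λ m → Σ≤ a (λ k → summand a b m k s))
      ≡⟨ Σ≤-zero M (λ m _ → Σ≤-zero a (λ k _ → summand-t<s a b m k (≰⇒> s≰t))) ⟩
    0
      ≡⟨ cong (_* stirling₂ (a + b ∸ t) l) (*-zeroʳ (a C s)) ⟨
    (a C s) * 0 * stirling₂ (a + b ∸ t) l
      ≡⟨ cong (λ i → (a C s) * binom b i * stirling₂ (a + b ∸ t) l) (-ℤ-< (≰⇒> s≰t)) ⟨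
    (a C s) * binom b (+ t -ℤ + s) * stirling₂ (a + b ∸ t) l
      ∎
  ... | yes s≤t = begin
    Σ≤ M (λ m → Σ≤ a (λ k → summand a b m k s))
      ≡⟨ Σ≤-cong M (λ m _ → Σ≤-cong a (λ k _ → summand-s≤t a b m k s≤t)) ⟩
    Σ≤ M (λ m → Σ≤ a (λ k →
      (b C d) * stirling₂ b′ m * ((a C k) * (k C s) * (m ^ (k ∸ s) * stirling₂∸ (a ∸ k) l m))))
      ≡⟨ Σ≤-cong M (λ m _ → trans (sym (*-distribˡ-Σ≤ a ((b C d) * stirling₂ b′ m) _))
                              (cong ((b C d) * stirling₂ b′ m *_) (Σ≤-trinomial-rStirling m l s≤a))) ⟩
    Σ≤ M (λ m → (b C d) * stirling₂ b′ m * ((a C s) * rStirling a′ m l))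
      ≡⟨ Σ≤-cong M (λ m _ → regroup (b C d) (stirling₂ b′ m) (a C s) (rStirling a′ m l)) ⟩
    Σ≤ M (λ m → (a C s) * ((b C d) * (stirling₂ b′ m * rStirling a′ m l)))
      ≡⟨ trans (cong ((a C s) *_) (*-distribˡ-Σ≤ M (b C d) _)) (*-distribˡ-Σ≤ M (a C s) _) ⟨
    (a C s) * ((b C d) * Σ≤ M (λ m → stirling₂ b′ m * rStirling a′ m l))
      ≡⟨ cong ((a C s) *_) (C*-cong b d λ d≤b → trans (stirling₂-addition a′ b′ M l (≤-trans (m∸n≤m b d) b≤M))
                                                      (cong (λ n → stirling₂ n l) (b∸[t∸s]+[a∸s]≡a+b∸t s≤a s≤t d≤b))) ⟩
    (a C s) * ((b C d) * stirling₂ (a + b ∸ t) l)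
      ≡⟨ *-assoc (a C s) (b C d) _ ⟨
    (a C s) * (b C d) * stirling₂ (a + b ∸ t) l
      ≡⟨ cong (λ i → (a C s) * binom b i * stirling₂ (a + b ∸ t) l) (-ℤ-≥ s≤t) ⟨
    (a C s) * binom b (+ t -ℤ + s) * stirling₂ (a + b ∸ t) l
      ∎
    where
    d = t ∸ s
    a′ = a ∸ s
    b′ = b ∸ d
    regroup : ∀ x y z w → x * y * (z * w) ≡ z * (x * (y * w))
    regroup = solve-∀

  Σ≤-summand : ∀ {a b} M → b ≤ M →
    Σ≤ M (λ m → Σ≤ a (λ k → Σ≤ k (λ s → summand a b m k s))) ≡ ((a + b) C t) * stirling₂ (a + b ∸ t) l
  Σ≤-summand {a} {b} M b≤M = begin
    Σ≤ M (λ m → Σ≤ a (λ k → Σ≤ k (λ s → summand a b m k s)))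
      ≡⟨ Σ≤-cong M (λ m _ → Σ≤-cong a (λ k k≤a → Σ≤-extend _ k≤a (λ s → summand-k<s a b m))) ⟩
    Σ≤ M (λ m → Σ≤ a (λ k → Σ≤ a (λ s → summand a b m k s)))
      ≡⟨ Σ≤-cong M (λ m _ → Σ≤-comm a a _) ⟩
    Σ≤ M (λ m → Σ≤ a (λ s → Σ≤ a (λ k → summand a b m k s)))
      ≡⟨ Σ≤-comm M a _ ⟩
    Σ≤ a (λ s → Σ≤ M (λ m → Σ≤ a (λ k → summand a b m k s)))
      ≡⟨ Σ≤-cong a (λ s s≤a → Σ≤-summand-at M b≤M s≤a) ⟩
    Σ≤ a (λ s → (a C s) * binom b (+ t -ℤ + s) * stirling₂ (a + b ∸ t) l)
      ≡⟨ *-distribʳ-Σ≤ a _ _ ⟨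
    Σ≤ a (λ s → (a C s) * binom b (+ t -ℤ + s)) * stirling₂ (a + b ∸ t) l
      ≡⟨ cong (_* stirling₂ (a + b ∸ t) l) (vandermonde a b t) ⟩
    ((a + b) C t) * stirling₂ (a + b ∸ t) l
      ∎

  *-distribˡ-Σ≤-summand : ∀ c₁ c₂ a b M → b ≤ M →
    c₁ * (c₂ * (((a + b) C t) * stirling₂ (a + b ∸ t) l)) ≡
    Σ≤ M (λ m → Σ≤ a (λ k → Σ≤ k (λ s →
      c₁ * c₂ * binom a (+ k) * binom b (+ t -ℤ + s) * binom k (+ s) * m ^ (k ∸ s)
        * S (+ b -ℤ + t +ℤ + s) (+ m) * S (+ a -ℤ + k) (+ l -ℤ + m))))
  *-distribˡ-Σ≤-summand c₁ c₂ a b M b≤M = begin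
    c₁ * (c₂ * (((a + b) C t) * stirling₂ (a + b ∸ t) l))
      ≡⟨ *-assoc c₁ c₂ _ ⟨
    c₁ * c₂ * (((a + b) C t) * stirling₂ (a + b ∸ t) l)
      ≡⟨ cong (c₁ * c₂ *_) (Σ≤-summand M b≤M) ⟨
    c₁ * c₂ * Σ≤ M (λ m → Σ≤ a (λ k → Σ≤ k (λ s → summand a b m k s)))
      ≡⟨ trans (*-distribˡ-Σ≤ M (c₁ * c₂) _) (Σ≤-cong M λ m _ →
         trans (*-distribˡ-Σ≤ a (c₁ * c₂) _) (Σ≤-cong a λ k _ →
         trans (*-distribˡ-Σ≤ k (c₁ * c₂) _) (Σ≤-cong k λ s _ → regroup c₁ c₂ _ _ _ _ _ _))) ⟩
    Σ≤ M (λ m → Σ≤ a (λ k → Σ≤ k (λ s →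
      c₁ * c₂ * binom a (+ k) * binom b (+ t -ℤ + s) * binom k (+ s) * m ^ (k ∸ s)
        * S (+ b -ℤ + t +ℤ + s) (+ m) * S (+ a -ℤ + k) (+ l -ℤ + m))))
      ∎
    where
    regroup : ∀ c₁ c₂ x₁ x₂ x₃ x₄ x₅ x₆ →
      c₁ * c₂ * (x₁ * x₂ * x₃ * x₄ * x₅ * x₆) ≡ c₁ * c₂ * x₁ * x₂ * x₃ * x₄ * x₅ * x₆
    regroup = solve-∀

corollary3 : (p₁ p₂ q₁ q₂ l t : ℕ) → l ≤ p₁ + p₂ + q₁ + q₂ → t ≤ p₁ + p₂ + q₁ + q₂ →
    Σ≤ (q₁ + q₂) (λ r →
        binom (p₁ + p₂ + r) (+ t) * binom (q₁ + q₂) (+ r)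
          * S (+ (p₁ + p₂ + r) -ℤ + t) (+ l))
    ≡
    Σ≤ (p₂ + q₂) (λ m → Σ≤ q₁ (λ r₁ → Σ≤ q₂ (λ r₂ → Σ≤ (p₁ + r₁) (λ k → Σ≤ k (λ s →
        binom q₁ (+ r₁) * binom q₂ (+ r₂) * binom (p₁ + r₁) (+ k)
          * binom (p₂ + r₂) (+ t -ℤ + s) * binom k (+ s) * m ^ (k ∸ s)
          * S (+ (p₂ + r₂) -ℤ + t +ℤ + s) (+ m)
          * S (+ (p₁ + r₁) -ℤ + k) (+ l -ℤ + m))))))
corollary3 p₁ p₂ q₁ q₂ l t _ _ = begin
  Σ≤ (q₁ + q₂) (λ r → binom (p₁ + p₂ + r) (+ t) * binom (q₁ + q₂) (+ r) * S (+ (p₁ + p₂ + r) -ℤ + t) (+ l))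
    ≡⟨ Σ≤-cong (q₁ + q₂) (λ r _ → trans (xy∙z≈y∙xz *-commutativeSemigroup ((p₁ + p₂ + r) C t) ((q₁ + q₂) C r) _)
                                         (cong (((q₁ + q₂) C r) *_) (nCi*S[n-i]≡nCi*S[n∸i] (p₁ + p₂ + r) t (+ l)))) ⟩
  Σ≤ (q₁ + q₂) (λ r → ((q₁ + q₂) C r) * T (p₁ + p₂ + r))
    ≡⟨ Σ≤-vandermonde q₁ q₂ (λ r → T (p₁ + p₂ + r)) ⟩
  Σ≤ q₁ (λ r₁ → (q₁ C r₁) * Σ≤ q₂ (λ r₂ → (q₂ C r₂) * T (p₁ + p₂ + (r₁ + r₂))))
    ≡⟨ Σ≤-cong q₁ (λ r₁ _ → trans (*-distribˡ-Σ≤ q₂ (q₁ C r₁) _) (Σ≤-cong q₂ (λ r₂ → expand r₁ r₂))) ⟩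
  Σ≤ q₁ (λ r₁ → Σ≤ q₂ (λ r₂ → Σ≤ (p₂ + q₂) (λ m → F m r₁ r₂)))
    ≡⟨ trans (Σ≤-cong q₁ (λ r₁ _ → Σ≤-comm q₂ (p₂ + q₂) _)) (Σ≤-comm q₁ (p₂ + q₂) _) ⟩
  Σ≤ (p₂ + q₂) (λ m → Σ≤ q₁ (λ r₁ → Σ≤ q₂ (λ r₂ → F m r₁ r₂)))
    ∎
  where
  T : ℕ → ℕ
  T n = (n C t) * stirling₂ (n ∸ t) l
  F : ℕ → ℕ → ℕ → ℕ
  F m r₁ r₂ = Σ≤ (p₁ + r₁) (λ k → Σ≤ k (λ s →
        binom q₁ (+ r₁) * binom q₂ (+ r₂) * binom (p₁ + r₁) (+ k)
          * binom (p₂ + r₂) (+ t -ℤ + s) * binom k (+ s) * m ^ (k ∸ s)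
          * S (+ (p₂ + r₂) -ℤ + t +ℤ + s) (+ m)
          * S (+ (p₁ + r₁) -ℤ + k) (+ l -ℤ + m)))
  expand : ∀ r₁ r₂ → r₂ ≤ q₂ →
    (q₁ C r₁) * ((q₂ C r₂) * T (p₁ + p₂ + (r₁ + r₂))) ≡ Σ≤ (p₂ + q₂) (λ m → F m r₁ r₂)
  expand r₁ r₂ r₂≤q₂ = begin
    (q₁ C r₁) * ((q₂ C r₂) * T (p₁ + p₂ + (r₁ + r₂)))
      ≡⟨ cong (λ n → (q₁ C r₁) * ((q₂ C r₂) * T n)) (interchange +-commutativeSemigroup p₁ p₂ r₁ r₂) ⟩
    (q₁ C r₁) * ((q₂ C r₂) * T (p₁ + r₁ + (p₂ + r₂)))
      ≡⟨ *-distribˡ-Σ≤-summand t l (q₁ C r₁) (q₂ C r₂) (p₁ + r₁) (p₂ + r₂) (p₂ + q₂) (+-monoʳ-≤ p₂ r₂≤q₂) ⟩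
    Σ≤ (p₂ + q₂) (λ m → F m r₁ r₂)
      ∎
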